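{- Let $d$ be a positive integer and $G$ a graph on $n$ vertices of degeneracy $d$. Then there exists a $4d$-neighborhood-witnessing layered family $\mathcal{F}$ of $G$ with thickness at most $\lceil\log n\rceil$.
   Context: Logarithms are base 2. Layered family: given an ordered partition $\Pi=(L_1,\dots,L_m)$ of $V(G)$, the layer digraph has an arc $(u,v)$ iff $uv\in E(G)$, $u\in L_i$, $v\in L_j$, $j<i$. $v$ is a descendant of $u$ if there is a directed path from $u$ to $v$ (including $v=u$). For each vertex $u$ with no in-arcs, the set of $u$ and all its descendants belongs to $\mathcal{F}$. $\mathcal{F}$ is a layered family of $G$ if it arises this way from some ordered partition; its thickness is the smallest $k$ such that every member meets at most $k$ parts of $\Pi$. A layered family is $d'$-neighborhood-witnessing if for every vertex $v$ and every $F\in\mathcal{F}$ with $v\in F$, $|N[v]\setminus F|\le d'$, where $N[v]$ is the closed neighborhood. -}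

module Defs where

open import Data.Nat using (ℕ; suc; _≤_; _<_; _∸_)
open import Data.Fin using (Fin) renaming (_<_ to _<ᶠ_)
open import Data.Bool using (Bool; true; false; _∧_)
open import Data.List using (List; length)
open import Data.List.Membership.Propositional using () renaming (_∈_ to _∈ₗ_)
open import Data.Product using (Σ; ∃; _×_; _,_)
open import Data.Vec using (tabulate)
open import Data.Fin.Subset using (Subset; Nonempty; ∣_∣; _∩_) renaming (_∈_ to _∈ₛ_)
open import Relation.Nullary using (¬_)
open import Relation.Binary.PropositionalEquality using (_≡_)
open import Relation.Binary.Construct.Closure.ReflexiveTransitive using (Star)

record Graph (n : ℕ) : Set where
  field
    adj   : Fin n → Fin n → Bool
    sym   : ∀ u v → adj u v ≡ adj v u
    irrefl : ∀ v → adj v v ≡ false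
open Graph public

Edge : ∀ {n} → Graph n → Fin n → Fin n → Set
Edge G u v = adj G u v ≡ true

Nbhd : ∀ {n} → Graph n → Fin n → Subset n
Nbhd G v = tabulate (adj G v)

Degenerate : ∀ {n} → Graph n → ℕ → Set
Degenerate {n} G k = (S : Subset n) → Nonempty S →
  ∃ λ v → v ∈ₛ S × ∣ Nbhd G v ∩ S ∣ ≤ k

HasDegeneracy : ∀ {n} → Graph n → ℕ → Set
HasDegeneracy G d = Degenerate G d × (∀ k → k < d → ¬ Degenerate G k)

-- "the set {x | P x} has at most k elements": it is covered by a list of length ≤ k.
AtMost : ∀ {A : Set} → ℕ → (A → Set) → Set
AtMost {A} k P = Σ (List A) λ L → length L ≤ k × (∀ x → P x → x ∈ₗ L)

-- An ordered partition (L_1,…,L_m) of V(G): the part index of each vertex,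
-- with every part nonempty.
record OrderedPartition (n : ℕ) : Set where
  field
    m        : ℕ
    layer    : Fin n → Fin m
    nonempty : ∀ (i : Fin m) → ∃ λ v → layer v ≡ i
open OrderedPartition public

module _ {n : ℕ} (G : Graph n) (Π : OrderedPartition n) where

  Arc : Fin n → Fin n → Set
  Arc u v = Edge G u v × layer Π v <ᶠ layer Π u

  Descendant : Fin n → Fin n → Set
  Descendant u v = Star Arc u v

  -- u has no in-arcs; the members of the layered family are exactly the sets
  -- {v | Descendant u v} for such u.
  Source : Fin n → Set
  Source u = ∀ w → ¬ Arc w u

  ThicknessAtMost : ℕ → Set
  ThicknessAtMost k = ∀ u → Source u →
    AtMost k (λ (i : Fin (m Π)) → ∃ λ v → Descendant u v × layer Π v ≡ i)

  InClosedNbhd : Fin n → Fin n → Set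
  InClosedNbhd v w = (w ≡ v) Data.Sum.⊎ Edge G v w
    where import Data.Sum

  NeighbourhoodWitnessing : ℕ → Set
  NeighbourhoodWitnessing d' = ∀ v u → Source u → Descendant u v →
    AtMost d' (λ w → InClosedNbhd v w × ¬ Descendant u w)

-- Peel the graph: S₀ = V, and S_{k+1} is the set of vertices of S_k with more than 4d
-- neighbours in S_k; a vertex goes into layer k when it lies in S_k but not in S_{k+1}.
-- Every vertex set S of a d-degenerate graph spans at most d·|S| edges, so by Markov's
-- inequality fewer than half of the vertices of S_k survive into S_{k+1}; this makes
-- 2^k (|S_k| + 1) ≤ n + 1 while S_k ≠ ∅, and there are at most ⌈log₂ n⌉ layers.
-- A neighbour of v in a lower layer is an out-neighbour of v in the layer digraph, so it
-- lies in every member containing v; all other neighbours of v lie in S_{layer v}, where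
-- v has at most 4d neighbours.

module Submission where

open import Defs hiding (sym)
open import Data.Nat using (ℕ; _*_; _≤_; NonZero)
open import Data.Nat.Logarithm using (⌈log₂_⌉)
open import Data.Product using (_×_; ∃)

open import Data.Bool using (Bool; true; false; _∧_; not; if_then_else_)
open import Data.Bool.Properties using (¬-not) renaming (_≟_ to _≟ᵇ_)
open import Data.Fin using (Fin; zero; suc; toℕ; fromℕ<)
open import Data.Fin.Properties using (_≟_; toℕ-fromℕ<; toℕ-injective; toℕ<n)
open import Data.Fin.Subset using (∣_∣; _∩_) renaming (_∈_ to _∈ₛ_)
open import Data.List using ([]; _∷_; map; allFin)
open import Data.List.Membership.Propositional.Properties using (∈-map⁺; ∈-allFin)
open import Data.List.Properties using (length-map; length-tabulate)
open import Data.List.Relation.Unary.Any using (here; there)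
open import Data.Nat using (zero; suc; _+_; _∸_; _^_; _<_; _<?_; _<ᵇ_; >-nonZero⁻¹; z≤n; s≤s; s≤s⁻¹; z<s; s<s; s<s⁻¹; ⌈_/2⌉; ⌊_/2⌋)
open import Data.Nat.Logarithm using (⌈log₂⌉-mono-≤; ⌈log₂⌈n/2⌉⌉≡⌈log₂n⌉∸1)
open import Data.Nat.Properties hiding (_≟_)
open import Algebra.Properties.Semiring.Sum +-*-semiring using (sum; sum-cong-≗; ∑-distrib-+)
open import Data.Nat.Tactic.RingSolver using (solve-∀)
open import Data.Product using (_,_; proj₁; proj₂)
open import Data.Sum using (inj₁; inj₂)
open import Data.Vec using (tabulate; []; _∷_)
open import Data.Vec.Properties using ([]=⇒lookup; lookup⇒[]=; lookup∘tabulate)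
open import Function using (id; _∘_; _⇔_; mk⇔; Equivalence)
open import Relation.Binary.Construct.Closure.ReflexiveTransitive using (ε; _◅_; _◅◅_)
open import Relation.Binary.PropositionalEquality
  using (_≡_; refl; sym; trans; cong; cong₂; subst; subst₂; module ≡-Reasoning)
open import Relation.Nullary using (¬_; yes; no; does; contradiction; ofʸ; ofⁿ)
open import Relation.Unary using (Decidable)

open Equivalence using (to; from)

𝟙 : Bool → ℕ
𝟙 b = if b then 1 else 0

∑∈ : ∀ {k} → (Fin k → Bool) → (Fin k → ℕ) → ℕ
∑∈ P g = sum (λ i → if P i then g i else 0)

count : ∀ {k} → (Fin k → Bool) → ℕ
count P = ∑∈ P (λ _ → 1)

-- The test on i comes first, so that (P ∖ x) i evaluates to false or to P i
-- as soon as i and x are constructors.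
_∖_ : ∀ {k} → (Fin k → Bool) → Fin k → (Fin k → Bool)
(P ∖ x) i = not (does (i ≟ x)) ∧ P i

∑∈-cong : ∀ {k} (P : Fin k → Bool) {g h : Fin k → ℕ} → (∀ i → g i ≡ h i) → ∑∈ P g ≡ ∑∈ P h
∑∈-cong P g≗h = sum-cong-≗ (λ i → cong (λ x → if P i then x else 0) (g≗h i))

∑∈-distrib-+ : ∀ {k} (P : Fin k → Bool) (g h : Fin k → ℕ) → ∑∈ P (λ i → g i + h i) ≡ ∑∈ P g + ∑∈ P h
∑∈-distrib-+ P g h =
  trans (sum-cong-≗ split) (∑-distrib-+ (λ i → if P i then g i else 0) (λ i → if P i then h i else 0))
  where
  split : ∀ i → (if P i then g i + h i else 0) ≡ (if P i then g i else 0) + (if P i then h i else 0)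
  split i with P i
  ... | true  = refl
  ... | false = refl

∑∈-empty : ∀ {k} (P : Fin k → Bool) (g : Fin k → ℕ) → (∀ i → P i ≡ false) → ∑∈ P g ≡ 0
∑∈-empty {zero}  P g none = refl
∑∈-empty {suc k} P g none rewrite none zero = ∑∈-empty (P ∘ suc) (g ∘ suc) (none ∘ suc)

∑∈-pick : ∀ {k} (P : Fin k → Bool) (g : Fin k → ℕ) {x} → P x ≡ true → ∑∈ P g ≡ g x + ∑∈ (P ∖ x) g
∑∈-pick {suc k} P g {zero} Px rewrite Px = refl
∑∈-pick {suc k} P g {suc x} Px = begin
    head + ∑∈ (P ∘ suc) (g ∘ suc)
  ≡⟨ cong (head +_) (∑∈-pick (P ∘ suc) (g ∘ suc) Px) ⟩
    head + (g (suc x) + ∑∈ ((P ∘ suc) ∖ x) (g ∘ suc))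
  ≡⟨ swap head (g (suc x)) _ ⟩
    g (suc x) + (head + ∑∈ ((P ∘ suc) ∖ x) (g ∘ suc))
  ∎
  where
  open ≡-Reasoning
  head : ℕ
  head = if P zero then g zero else 0
  swap : ∀ a b c → a + (b + c) ≡ b + (a + c)
  swap = solve-∀

count-pick : ∀ {k} (P : Fin k → Bool) {x} → P x ≡ true → count P ≡ suc (count (P ∖ x))
count-pick P = ∑∈-pick P (λ _ → 1)

count-∧ : ∀ {k} (P Q : Fin k → Bool) → count (λ i → P i ∧ Q i) ≡ ∑∈ P (λ i → 𝟙 (Q i))
count-∧ P Q = sum-cong-≗ pointwise
  where
  pointwise : ∀ i → 𝟙 (P i ∧ Q i) ≡ (if P i then 𝟙 (Q i) else 0)
  pointwise i with P i
  ... | true  = refl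
  ... | false = refl

count-pos : ∀ {k} (P : Fin k → Bool) {x} → P x ≡ true → 0 < count P
count-pos P Px = subst (0 <_) (sym (count-pick P Px)) z<s

count≡0⇒false : ∀ {k} (P : Fin k → Bool) → count P ≡ 0 → ∀ i → P i ≡ false
count≡0⇒false P empty i with P i in Pi
... | false = refl
... | true  = contradiction empty (>⇒≢ (count-pos P Pi))

count-pos⇒∃ : ∀ {k} (P : Fin k → Bool) → 0 < count P → ∃ λ i → P i ≡ true
count-pos⇒∃ {suc k} P pos with P zero in P0
... | true  = zero , P0
... | false = let i , Pi = count-pos⇒∃ (P ∘ suc) pos in suc i , Pi

count≤ : ∀ {k} (P : Fin k → Bool) → count P ≤ k
count≤ {zero}  P = z≤n
count≤ {suc k} P with P zero
... | true  = s≤s (count≤ (P ∘ suc))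
... | false = m≤n⇒m≤1+n (count≤ (P ∘ suc))

count-<⇒∃ : ∀ {k} (P Q : Fin k → Bool) → (∀ i → P i ≡ true → Q i ≡ true) →
            count P < count Q → ∃ λ i → Q i ≡ true × P i ≡ false
count-<⇒∃ {suc k} P Q P⊆Q lt with P zero in P0 | Q zero in Q0
... | false | true  = zero , Q0 , P0
... | true  | false = contradiction (trans (sym (P⊆Q zero P0)) Q0) λ ()
... | true  | true  = let i , Qi , ¬Pi = count-<⇒∃ (P ∘ suc) (Q ∘ suc) (P⊆Q ∘ suc) (s<s⁻¹ lt)
                      in suc i , Qi , ¬Pi
... | false | false = let i , Qi , ¬Pi = count-<⇒∃ (P ∘ suc) (Q ∘ suc) (P⊆Q ∘ suc) lt
                      in suc i , Qi , ¬Pi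

markov : ∀ {k} (P : Fin k → Bool) (g : Fin k → ℕ) q →
         count (λ i → P i ∧ (q <ᵇ g i)) * suc q ≤ ∑∈ P g
markov {zero}  P g q = z≤n
markov {suc k} P g q with P zero | q <ᵇ g zero | <ᵇ-reflects-< q (g zero)
... | true  | true  | ofʸ q<g = +-mono-≤ q<g (markov (P ∘ suc) (g ∘ suc) q)
... | true  | false | _       = ≤-trans (markov (P ∘ suc) (g ∘ suc) q) (m≤n+m _ (g zero))
... | false | _     | _       = markov (P ∘ suc) (g ∘ suc) q

AtMost-count : ∀ {k} (P : Fin k → Bool) → AtMost (count P) (λ i → P i ≡ true)
AtMost-count {zero}  P = [] , z≤n , λ ()
AtMost-count {suc k} P with P zero in P0 | AtMost-count (P ∘ suc)
... | true  | L , len , covers =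
  zero ∷ map suc L , s≤s (≤-trans (≤-reflexive (length-map suc L)) len) ,
  λ { zero _ → here refl ; (suc i) Pi → there (∈-map⁺ suc (covers i Pi)) }
... | false | L , len , covers =
  map suc L , ≤-trans (≤-reflexive (length-map suc L)) len ,
  λ { zero P0′ → contradiction (trans (sym P0) P0′) λ () ; (suc i) Pi → ∈-map⁺ suc (covers i Pi) }

AtMost-mono : ∀ {A : Set} {k l} {P Q : A → Set} → k ≤ l → (∀ x → Q x → P x) → AtMost k P → AtMost l Q
AtMost-mono k≤l Q⊆P (L , len , covers) = L , ≤-trans len k≤l , λ x Qx → covers x (Q⊆P x Qx)

∣tabulate∩tabulate∣ : ∀ {k} (Q P : Fin k → Bool) → ∣ tabulate Q ∩ tabulate P ∣ ≡ ∑∈ P (λ i → 𝟙 (Q i))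
∣tabulate∩tabulate∣ {zero}  Q P = refl
∣tabulate∩tabulate∣ {suc k} Q P with Q zero | P zero
... | true  | true  = cong suc (∣tabulate∩tabulate∣ (Q ∘ suc) (P ∘ suc))
... | true  | false = ∣tabulate∩tabulate∣ (Q ∘ suc) (P ∘ suc)
... | false | true  = ∣tabulate∩tabulate∣ (Q ∘ suc) (P ∘ suc)
... | false | false = ∣tabulate∩tabulate∣ (Q ∘ suc) (P ∘ suc)

n<2^n : ∀ n → n < 2 ^ n
n<2^n zero    = z<s
n<2^n (suc n) = +-mono-≤ (m^n>0 2 n) (≤-trans (n<2^n n) (m≤m+n (2 ^ n) 0))

2^k<n⇒k<⌈log₂n⌉ : ∀ k n → 2 ^ k < n → k < ⌈log₂ n ⌉
2^k<n⇒k<⌈log₂n⌉ zero    n 2≤n = ⌈log₂⌉-mono-≤ 2≤n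
2^k<n⇒k<⌈log₂n⌉ (suc k) n 2^k+1<n =
  <∸1⇒suc< (subst (k <_) (⌈log₂⌈n/2⌉⌉≡⌈log₂n⌉∸1 n) (2^k<n⇒k<⌈log₂n⌉ k ⌈ n /2⌉ 2^k<⌈n/2⌉))
  where
  open ≤-Reasoning
  <∸1⇒suc< : ∀ {l} → k < l ∸ 1 → suc k < l
  <∸1⇒suc< {suc l} k<l = s<s k<l
  2^k<⌈n/2⌉ : 2 ^ k < ⌈ n /2⌉
  2^k<⌈n/2⌉ = ≰⇒> λ ⌈n/2⌉≤2^k → <⇒≱ 2^k+1<n (begin
    n                   ≡⟨ ⌊n/2⌋+⌈n/2⌉≡n n ⟨
    ⌊ n /2⌋ + ⌈ n /2⌉   ≤⟨ +-mono-≤ (≤-trans (⌊n/2⌋≤⌈n/2⌉ n) ⌈n/2⌉≤2^k) ⌈n/2⌉≤2^k ⟩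
    2 ^ k + 2 ^ k       ≡⟨ cong (2 ^ k +_) (+-identityʳ (2 ^ k)) ⟨
    2 ^ suc k           ∎)

*2≤1+⇒< : ∀ {a m} → 2 ≤ m → a * 2 ≤ suc m → a < m
*2≤1+⇒< {a} {m} 2≤m a*2≤1+m = ≰⇒> λ m≤a → <⇒≱ 2≤m (+-cancelʳ-≤ m m 1 (begin
    m + m    ≡⟨ cong (m +_) (+-identityʳ m) ⟨
    2 * m    ≡⟨ *-comm 2 m ⟩
    m * 2    ≤⟨ *-monoˡ-≤ 2 m≤a ⟩
    a * 2    ≤⟨ a*2≤1+m ⟩
    1 + m    ∎))
  where open ≤-Reasoning

markov-halving : ∀ d h c → h * suc (4 * d) ≤ 2 * d * c → 0 < c → 2 * h < c
markov-halving d h c bound c>0 = ≰⇒> λ c≤2h → <⇒≱ c>0 (subst (c ≤_) (cong (2 *_) (h≡0 c≤2h)) c≤2h)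
  where
  open ≤-Reasoning
  expand : ∀ h d → h + 2 * d * (2 * h) ≡ h * suc (4 * d)
  expand = solve-∀
  h≡0 : c ≤ 2 * h → h ≡ 0
  h≡0 c≤2h = n≤0⇒n≡0 (+-cancelʳ-≤ (2 * d * (2 * h)) h 0 (begin
    h + 2 * d * (2 * h)  ≡⟨ expand h d ⟩
    h * suc (4 * d)      ≤⟨ bound ⟩
    2 * d * c            ≤⟨ *-monoʳ-≤ (2 * d) c≤2h ⟩
    2 * d * (2 * h)      ∎))

prefix-length : ∀ {p} {P : ℕ → Set p} → Decidable P → (∀ {k} → P (suc k) → P k) →
                ∀ N → ¬ P N → ∃ λ L → ∀ k → P k ⇔ k < L
prefix-length {P = P} P? down N ¬PN with P? 0
... | no ¬P0 = 0 , λ k → mk⇔ (λ Pk → contradiction (to-0 k Pk) ¬P0) λ ()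
  where
  to-0 : ∀ k → P k → P 0
  to-0 zero    P0 = P0
  to-0 (suc k) Pk = to-0 k (down Pk)
prefix-length P? down zero    ¬P0 | yes P0 = contradiction P0 ¬P0
prefix-length P? down (suc N) ¬PN | yes P0 =
  let L , spec = prefix-length (P? ∘ suc) down N ¬PN in
  suc L , λ { zero    → mk⇔ (λ _ → z<s) (λ _ → P0)
            ; (suc k) → mk⇔ (s<s ∘ to (spec k)) (from (spec k) ∘ s<s⁻¹) }

≤1-vertices⇒0-degenerate : ∀ {n} (G : Graph n) → n ≤ 1 → Degenerate G 0
≤1-vertices⇒0-degenerate {zero}  G _ S (() , _)
≤1-vertices⇒0-degenerate {suc zero} G _ (s ∷ []) (zero , zero∈S) =
  zero , zero∈S , ≤-reflexive (cong (λ b → ∣ (b ∧ s) ∷ [] ∣) (irrefl G zero))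
≤1-vertices⇒0-degenerate {suc (suc n)} G (s≤s ())

module Degrees {n} (G : Graph n) where

  deg : (Fin n → Bool) → Fin n → ℕ
  deg T v = ∑∈ T (λ w → 𝟙 (adj G v w))

  degSum : (Fin n → Bool) → ℕ
  degSum T = ∑∈ T (deg T)

  deg-pick : ∀ T {x} v → T x ≡ true → deg T v ≡ 𝟙 (adj G v x) + deg (T ∖ x) v
  deg-pick T v = ∑∈-pick T (λ w → 𝟙 (adj G v w))

  degSum-pick : ∀ T {x} → T x ≡ true → degSum T ≡ deg T x + (deg (T ∖ x) x + degSum (T ∖ x))
  degSum-pick T {x} Tx = begin
      degSum T
    ≡⟨ ∑∈-pick T (deg T) Tx ⟩
      deg T x + ∑∈ (T ∖ x) (deg T)
    ≡⟨ cong (deg T x +_) (∑∈-cong (T ∖ x) λ v → deg-pick T v Tx) ⟩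
      deg T x + ∑∈ (T ∖ x) (λ v → 𝟙 (adj G v x) + deg (T ∖ x) v)
    ≡⟨ cong (deg T x +_) (∑∈-distrib-+ (T ∖ x) (λ v → 𝟙 (adj G v x)) (deg (T ∖ x))) ⟩
      deg T x + (∑∈ (T ∖ x) (λ v → 𝟙 (adj G v x)) + degSum (T ∖ x))
    ≡⟨ cong (λ e → deg T x + (e + degSum (T ∖ x))) (∑∈-cong (T ∖ x) λ v → cong 𝟙 (Graph.sym G v x)) ⟩
      deg T x + (deg (T ∖ x) x + degSum (T ∖ x))
    ∎
    where open ≡-Reasoning

  low-degree-vertex : ∀ {d} → Degenerate G d → ∀ T {x} → T x ≡ true → ∃ λ v → T v ≡ true × deg T v ≤ d
  low-degree-vertex dg T {x} Tx =
    let v , v∈T , small = dg (tabulate T) (x , ∈tabulate x Tx) in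
    v , trans (sym (lookup∘tabulate T v)) ([]=⇒lookup v∈T) ,
    subst (_≤ _) (∣tabulate∩tabulate∣ (adj G v) T) small
    where
    ∈tabulate : ∀ v → T v ≡ true → v ∈ₛ tabulate T
    ∈tabulate v Tv = lookup⇒[]= v (tabulate T) (trans (lookup∘tabulate T v) Tv)

  degSum≤2d*count : ∀ {d} → Degenerate G d → ∀ T → degSum T ≤ 2 * d * count T
  degSum≤2d*count {d} dg T = go (count T) T refl
    where
    go : ∀ c T → count T ≡ c → degSum T ≤ 2 * d * c
    go zero    T empty = ≤-trans (≤-reflexive (∑∈-empty T (deg T) (count≡0⇒false T empty))) z≤n
    go (suc c) T size with low-degree-vertex dg T (proj₂ (count-pos⇒∃ T (subst (0 <_) (sym size) z<s)))
    ... | x , Tx , small = begin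
        degSum T                                      ≡⟨ degSum-pick T Tx ⟩
        deg T x + (deg (T ∖ x) x + degSum (T ∖ x))    ≤⟨ +-mono-≤ small (+-mono-≤ small′ (go c (T ∖ x) size′)) ⟩
        d + (d + 2 * d * c)                           ≡⟨ collect d c ⟩
        2 * d * suc c                                 ∎
      where
      open ≤-Reasoning
      small′ : deg (T ∖ x) x ≤ d
      small′ = ≤-trans (m≤n+m _ _) (subst (_≤ d) (deg-pick T x Tx) small)
      size′ : count (T ∖ x) ≡ c
      size′ = suc-injective (trans (sym (count-pick T Tx)) size)
      collect : ∀ d c → d + (d + 2 * d * c) ≡ 2 * d * suc c
      collect = solve-∀

module Peeling {n} (G : Graph n) (d : ℕ) (dg : Degenerate G d) where

  open Degrees G

  heavy : (Fin n → Bool) → Fin n → Bool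
  heavy T v = T v ∧ (4 * d <ᵇ deg T v)

  heavy⊆ : ∀ T {v} → heavy T v ≡ true → T v ≡ true
  heavy⊆ T {v} hv with T v
  ... | true  = refl
  ... | false = hv

  ¬heavy⇒low : ∀ T {v} → T v ≡ true → heavy T v ≡ false → deg T v ≤ 4 * d
  ¬heavy⇒low T {v} Tv light with 4 * d <ᵇ deg T v | <ᵇ-reflects-< (4 * d) (deg T v)
  ... | false | ofⁿ ≯ = ≮⇒≥ ≯
  ... | true  | _     = contradiction (trans (cong (_∧ true) (sym Tv)) light) λ ()

  heavy-halves : ∀ T → 0 < count T → 2 * count (heavy T) < count T
  heavy-halves T = markov-halving d (count (heavy T)) (count T)
    (≤-trans (markov T (deg T) (4 * d)) (degSum≤2d*count dg T))

  peel : ℕ → Fin n → Bool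
  peel zero    _ = true
  peel (suc k) = heavy (peel k)

  peel-nonempty-anti : ∀ k → 0 < count (peel (suc k)) → 0 < count (peel k)
  peel-nonempty-anti k pos =
    let v , v∈ = count-pos⇒∃ (peel (suc k)) pos in count-pos (peel k) (heavy⊆ (peel k) v∈)

  peel-size : ∀ k → 0 < count (peel k) → 2 ^ k * suc (count (peel k)) ≤ suc n
  peel-size zero    _   = ≤-trans (≤-reflexive (+-identityʳ _)) (s≤s (count≤ (peel 0)))
  peel-size (suc k) pos = begin
      2 ^ suc k * suc (count (peel (suc k)))     ≡⟨ regroup (2 ^ k) (count (peel (suc k))) ⟩
      2 ^ k * (2 + 2 * count (peel (suc k)))     ≤⟨ *-monoʳ-≤ (2 ^ k) (s≤s (heavy-halves (peel k) (peel-nonempty-anti k pos))) ⟩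
      2 ^ k * suc (count (peel k))               ≤⟨ peel-size k (peel-nonempty-anti k pos) ⟩
      suc n                                      ∎
    where
    open ≤-Reasoning
    regroup : ∀ a c → 2 * a * suc c ≡ a * (2 + 2 * c)
    regroup = solve-∀

  peel-bound : ∀ k → 0 < count (peel k) → 2 ^ k * 2 ≤ suc n
  peel-bound k pos = ≤-trans (*-monoʳ-≤ (2 ^ k) (s≤s pos)) (peel-size k pos)

  peel-exhausted : ¬ 0 < count (peel (suc n))
  peel-exhausted pos = <⇒≱ (≤-trans (n<2^n (suc n)) (m≤m*n (2 ^ suc n) 2)) (peel-bound (suc n) pos)

  -- Opaque, so that comparing ranks never makes the typechecker unfold the search.
  opaque
    rank-exists : ∀ v → ∃ λ r → ∀ k → peel (suc k) v ≡ true ⇔ k < r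
    rank-exists v = prefix-length (λ k → peel (suc k) v ≟ᵇ true) (λ {k} → heavy⊆ (peel (suc k))) n
      (λ v∈ → peel-exhausted (count-pos (peel (suc n)) v∈))

  rank : Fin n → ℕ
  rank v = proj₁ (rank-exists v)

  peel⇔≤rank : ∀ v k → peel k v ≡ true ⇔ k ≤ rank v
  peel⇔≤rank v zero    = mk⇔ (λ _ → z≤n) (λ _ → refl)
  peel⇔≤rank v (suc k) = proj₂ (rank-exists v) k

  rank-exact : ∀ {w k} → peel k w ≡ true → peel (suc k) w ≡ false → rank w ≡ k
  rank-exact {w} {k} w∈ w∉ = ≤-antisym
    (≮⇒≥ λ k<r → contradiction (trans (sym (from (peel⇔≤rank w (suc k)) k<r)) w∉) λ ())
    (to (peel⇔≤rank w k) w∈)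

  opaque
    depth-exists : ∃ λ m → ∀ k → 0 < count (peel k) ⇔ k < m
    depth-exists = prefix-length (λ k → 0 <? count (peel k)) (λ {k} → peel-nonempty-anti k) (suc n) peel-exhausted

  depth : ℕ
  depth = proj₁ depth-exists

  nonempty⇔<depth : ∀ k → 0 < count (peel k) ⇔ k < depth
  nonempty⇔<depth = proj₂ depth-exists

  rank<depth : ∀ v → rank v < depth
  rank<depth v = to (nonempty⇔<depth (rank v)) (count-pos (peel (rank v)) (from (peel⇔≤rank v (rank v)) ≤-refl))

  <depth⇒<⌈log₂n⌉ : 2 ≤ n → ∀ {k} → k < depth → k < ⌈log₂ n ⌉
  <depth⇒<⌈log₂n⌉ 2≤n {k} k<depth =
    2^k<n⇒k<⌈log₂n⌉ k n (*2≤1+⇒< 2≤n (peel-bound k (from (nonempty⇔<depth k) k<depth)))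

  depth≤⌈log₂n⌉ : 2 ≤ n → depth ≤ ⌈log₂ n ⌉
  depth≤⌈log₂n⌉ 2≤n with depth | <depth⇒<⌈log₂n⌉ 2≤n
  ... | zero  | _     = z≤n
  ... | suc r | bound = bound ≤-refl

  layering : OrderedPartition n
  layering = record { m = depth ; layer = λ v → fromℕ< (rank<depth v) ; nonempty = layer-nonempty }
    where
    layer-nonempty : ∀ i → ∃ λ v → fromℕ< (rank<depth v) ≡ i
    layer-nonempty i =
      let S = peel (toℕ i)
          w , w∈ , w∉ = count-<⇒∃ (heavy S) S (λ _ → heavy⊆ S)
            (≤-<-trans (m≤m+n _ _) (heavy-halves S (from (nonempty⇔<depth (toℕ i)) (toℕ<n i))))
      in w , toℕ-injective (trans (toℕ-fromℕ< (rank<depth w)) (rank-exact w∈ w∉))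

  rank<⇒arc : ∀ {v w} → Edge G v w → rank w < rank v → Arc G layering v w
  rank<⇒arc {v} {w} vw w<v = vw , subst₂ _<_ (sym (toℕ-fromℕ< (rank<depth w))) (sym (toℕ-fromℕ< (rank<depth v))) w<v

  layering-witnessing : NeighbourhoodWitnessing G layering (4 * d)
  layering-witnessing v u _ u⇝v =
    AtMost-mono (subst (_≤ 4 * d) (sym (count-∧ S (adj G v))) (¬heavy⇒low S v∈S v∉next))
      covered (AtMost-count (λ w → S w ∧ adj G v w))
    where
    S = peel (rank v)
    v∈S : S v ≡ true
    v∈S = from (peel⇔≤rank v (rank v)) ≤-refl
    v∉next : heavy S v ≡ false
    v∉next = ¬-not λ v∈next → n≮n (rank v) (to (peel⇔≤rank v (suc (rank v))) v∈next)
    covered : ∀ w → InClosedNbhd G layering v w × ¬ Descendant G layering u w → S w ∧ adj G v w ≡ true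
    covered w (inj₁ refl , u↛w) = contradiction u⇝v u↛w
    covered w (inj₂ vw , u↛w) with rank w <? rank v
    ... | yes w<v = contradiction (u⇝v ◅◅ rank<⇒arc vw w<v ◅ ε) u↛w
    ... | no  w≮v = cong₂ _∧_ (from (peel⇔≤rank w (rank v)) (≮⇒≥ w≮v)) vw

  layering-thin : 2 ≤ n → ThicknessAtMost G layering ⌈log₂ n ⌉
  layering-thin 2≤n _ _ =
    allFin depth , ≤-trans (≤-reflexive (length-tabulate id)) (depth≤⌈log₂n⌉ 2≤n) , λ i _ → ∈-allFin i

lemma8p1 : (d n : ℕ) → NonZero d → (G : Graph n) → HasDegeneracy G d →
    ∃ λ (Π : OrderedPartition n) →
      NeighbourhoodWitnessing G Π (4 * d) × ThicknessAtMost G Π ⌈log₂ n ⌉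
lemma8p1 d n d≢0 G (dg , minimal) = layering , layering-witnessing , layering-thin 2≤n
  where
  open Peeling G d dg
  -- ⌈log₂ n⌉ = 0 for n ≤ 1, where one layer would be too many; positive degeneracy excludes this.
  2≤n : 2 ≤ n
  2≤n = ≮⇒≥ λ n<2 → minimal 0 (>-nonZero⁻¹ d {{d≢0}}) (≤1-vertices⇒0-degenerate G (s≤s⁻¹ n<2))
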